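{- Let $g(x),f(x)$ be formal power series with integer coefficients and $g(0)=f(0)=1$, let $a_{n,k}=[x^n]g(x)(xf(x))^k$, and let $\phi(x)$ be the reversion of $x/f(x)$. Let $c(A;2)$ be the lower-triangular matrix with $(n,k)$ entry $a_{2n+1,n+k+1}$. Then $$c(A;2)=\left(\phi'(x)g(\phi(x)),\ \phi(x)f(\phi(x))\right).$$
   Context: A Riordan array $(d(x),h(x))$, for formal power series $d,h$ with $d(0)\neq 0$, $h(0)=0$, $h'(0)\neq 0$, is the infinite lower-triangular matrix whose $(n,k)$ entry is $[x^n]d(x)h(x)^k$. The reversion of a power series $h$ with $h(0)=0$, $h'(0)\ne0$ is the power series $u$ with $u(0)=0$ and $h(u(x))=x$. $\phi'$ denotes the derivative of $\phi$. -}

module Defs where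

open import Data.Nat using (ℕ; zero; suc; _∸_)
open import Relation.Binary.PropositionalEquality using (_≡_)
open import Data.Integer using (ℤ; _+_; _*_; +_; 0ℤ; 1ℤ)

PS : Set
PS = ℕ → ℤ

sumUpTo : ℕ → (ℕ → ℤ) → ℤ
sumUpTo zero    f = f zero
sumUpTo (suc n) f = sumUpTo n f + f (suc n)

X : PS
X (suc zero) = 1ℤ
X _          = 0ℤ

one : PS
one zero    = 1ℤ
one (suc _) = 0ℤ

_⊛_ : PS → PS → PS
(a ⊛ b) n = sumUpTo n (λ i → a i * b (n ∸ i))

pow : PS → ℕ → PS
pow a zero    = one
pow a (suc k) = a ⊛ pow a k

deriv : PS → PS
deriv a n = (+ suc n) * a (suc n)

-- composition a(b(x)); meaningful (and used only) when b(0) = 0,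
-- in which case [x^n] b^k = 0 for k > n, so the sum is exact.
compose : PS → PS → PS
compose a b n = sumUpTo n (λ k → a k * pow b k n)

_≈ₚ_ : PS → PS → Set
a ≈ₚ b = ∀ n → a n ≡ b n

riordan : PS → PS → ℕ → ℕ → ℤ
riordan d h n k = (d ⊛ pow h k) n

-- Put ψ = f(φ) and W = x/φ = 1/ψ, so that φ = xψ.  Lagrange inversion in residue form says
-- [x^N] W^(N+1) φ' P(φ) = [y^N] P(y) for every series P: expanding P(φ) = Σ P_m φ^m reduces
-- this to [x^j] W^(j+1) φ' = δ_j0, and for j > 0 this coefficient is the residue of
-- φ'/φ^(j+1), a derivative.  With N = n + k and P = g y^(2k) f(y)^(N+1), [y^N] P is the
-- entry a_(2n+1,N+1), while W^(N+1) P(φ) = g(φ) φ^(2k) = x^k g(φ) (φ f(φ))^k, whose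
-- coefficient of x^N is the (n,k) entry of (φ' g(φ), φ f(φ)).
module Submission where

open import Defs
open import Data.Nat using (ℕ; zero; suc; _+_; _*_; _∸_; _≤_; _<_; z≤n; s≤s)
import Data.Nat.Properties as ℕₚ
open import Data.Integer using (ℤ; 1ℤ; 0ℤ; +_) renaming (_+_ to _+ᶻ_; _*_ to _*ᶻ_)
import Data.Integer.Properties as ℤₚ
open import Data.Product using (_,_)
open import Data.Sum using (inj₁; inj₂)
open import Data.Nat.Tactic.RingSolver using (solve-∀)
open import Level using (0ℓ)
open import Algebra.Bundles using (CommutativeSemiring)
open import Algebra.Structures using (IsCommutativeMonoid)
open import Algebra.Structures.Biased using (isCommutativeSemiringˡ)
import Algebra.Construct.Pointwise as Pointwise
import Algebra.Properties.CommutativeSemigroup as CommSemigroupProperties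
import Relation.Binary.Reasoning.Setoid
open import Relation.Binary.PropositionalEquality
  using (_≡_; refl; sym; trans; cong; cong₂; module ≡-Reasoning)
open CommSemigroupProperties ℤₚ.+-commutativeSemigroup
  using () renaming (interchange to +ᶻ-interchange)
open CommSemigroupProperties ℤₚ.*-commutativeSemigroup
  using () renaming (interchange to *ᶻ-interchange; x∙yz≈y∙xz to *ᶻ-left-comm)

sum-cong : ∀ n {f g : ℕ → ℤ} → (∀ i → i ≤ n → f i ≡ g i) → sumUpTo n f ≡ sumUpTo n g
sum-cong zero    f≡g = f≡g 0 z≤n
sum-cong (suc n) f≡g =
  cong₂ _+ᶻ_ (sum-cong n (λ i i≤n → f≡g i (ℕₚ.m≤n⇒m≤1+n i≤n))) (f≡g (suc n) ℕₚ.≤-refl)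

sum-zero : ∀ n {f : ℕ → ℤ} → (∀ i → i ≤ n → f i ≡ 0ℤ) → sumUpTo n f ≡ 0ℤ
sum-zero zero    f≡0 = f≡0 0 z≤n
sum-zero (suc n) f≡0 =
  cong₂ _+ᶻ_ (sum-zero n (λ i i≤n → f≡0 i (ℕₚ.m≤n⇒m≤1+n i≤n))) (f≡0 (suc n) ℕₚ.≤-refl)

sum-+ : ∀ n (f g : ℕ → ℤ) → sumUpTo n (λ i → f i +ᶻ g i) ≡ sumUpTo n f +ᶻ sumUpTo n g
sum-+ zero    f g = refl
sum-+ (suc n) f g = trans (cong (_+ᶻ (f (suc n) +ᶻ g (suc n))) (sum-+ n f g))
  (+ᶻ-interchange (sumUpTo n f) (sumUpTo n g) (f (suc n)) (g (suc n)))

sum-*ˡ : ∀ n c (f : ℕ → ℤ) → c *ᶻ sumUpTo n f ≡ sumUpTo n (λ i → c *ᶻ f i)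
sum-*ˡ zero    c f = refl
sum-*ˡ (suc n) c f = trans (ℤₚ.*-distribˡ-+ c (sumUpTo n f) (f (suc n)))
  (cong (_+ᶻ c *ᶻ f (suc n)) (sum-*ˡ n c f))

sum-*ʳ : ∀ n c (f : ℕ → ℤ) → sumUpTo n f *ᶻ c ≡ sumUpTo n (λ i → f i *ᶻ c)
sum-*ʳ zero    c f = refl
sum-*ʳ (suc n) c f = trans (ℤₚ.*-distribʳ-+ c (sumUpTo n f) (f (suc n)))
  (cong (_+ᶻ f (suc n) *ᶻ c) (sum-*ʳ n c f))

sum-product : ∀ n (f g : ℕ → ℤ) →
              sumUpTo n f *ᶻ sumUpTo n g ≡ sumUpTo n (λ k → sumUpTo n (λ l → f k *ᶻ g l))
sum-product n f g = trans (sum-*ʳ n (sumUpTo n g) f) (sum-cong n (λ k _ → sum-*ˡ n (f k) g))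

sum-split-head : ∀ n (f : ℕ → ℤ) → sumUpTo (suc n) f ≡ f 0 +ᶻ sumUpTo n (λ i → f (suc i))
sum-split-head zero    f = refl
sum-split-head (suc n) f = trans (cong (_+ᶻ f (suc (suc n))) (sum-split-head n f))
  (ℤₚ.+-assoc (f 0) (sumUpTo n (λ i → f (suc i))) (f (suc (suc n))))

sum-head : ∀ n (f : ℕ → ℤ) → (∀ i → f (suc i) ≡ 0ℤ) → sumUpTo n f ≡ f 0
sum-head zero    f tail≡0 = refl
sum-head (suc n) f tail≡0 = begin
  sumUpTo (suc n) f                      ≡⟨ sum-split-head n f ⟩
  f 0 +ᶻ sumUpTo n (λ i → f (suc i))     ≡⟨ cong (f 0 +ᶻ_) (sum-zero n (λ i _ → tail≡0 i)) ⟩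
  f 0 +ᶻ 0ℤ                              ≡⟨ ℤₚ.+-identityʳ (f 0) ⟩
  f 0                                    ∎
  where open ≡-Reasoning

sum-reverse : ∀ n (f : ℕ → ℤ) → sumUpTo n f ≡ sumUpTo n (λ i → f (n ∸ i))
sum-reverse zero    f = refl
sum-reverse (suc n) f = begin
  sumUpTo n f +ᶻ f (suc n)                     ≡⟨ cong (_+ᶻ f (suc n)) (sum-reverse n f) ⟩
  sumUpTo n (λ i → f (n ∸ i)) +ᶻ f (suc n)     ≡⟨ ℤₚ.+-comm _ (f (suc n)) ⟩
  f (suc n) +ᶻ sumUpTo n (λ i → f (n ∸ i))     ≡⟨ sum-split-head n (λ i → f (suc n ∸ i)) ⟨
  sumUpTo (suc n) (λ i → f (suc n ∸ i))        ∎
  where open ≡-Reasoning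

sum-extend : ∀ {m n} {f : ℕ → ℤ} → m ≤ n → (∀ j → m < j → j ≤ n → f j ≡ 0ℤ) →
             sumUpTo m f ≡ sumUpTo n f
sum-extend {n = zero}      z≤n  _   = refl
sum-extend {m} {suc n} {f} m≤1+n f≡0 with ℕₚ.m≤n⇒m<n∨m≡n m≤1+n
... | inj₂ refl        = refl
... | inj₁ (s≤s m≤n) = begin
  sumUpTo m f                 ≡⟨ sum-extend m≤n (λ j m<j j≤n → f≡0 j m<j (ℕₚ.m≤n⇒m≤1+n j≤n)) ⟩
  sumUpTo n f                 ≡⟨ ℤₚ.+-identityʳ (sumUpTo n f) ⟨
  sumUpTo n f +ᶻ 0ℤ           ≡⟨ cong (sumUpTo n f +ᶻ_) (f≡0 (suc n) (s≤s m≤n) ℕₚ.≤-refl) ⟨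
  sumUpTo (suc n) f           ∎
  where open ≡-Reasoning

sum-swap : ∀ n m (F : ℕ → ℕ → ℤ) →
           sumUpTo n (λ i → sumUpTo m (F i)) ≡ sumUpTo m (λ j → sumUpTo n (λ i → F i j))
sum-swap zero    m F = refl
sum-swap (suc n) m F = trans (cong (_+ᶻ sumUpTo m (F (suc n))) (sum-swap n m F))
  (sym (sum-+ m (λ j → sumUpTo n (λ i → F i j)) (F (suc n))))

sum-diagonal : ∀ n (H : ℕ → ℕ → ℤ) →
               sumUpTo n (λ m → sumUpTo m (λ k → H k (m ∸ k))) ≡ sumUpTo n (λ k → sumUpTo (n ∸ k) (H k))
sum-diagonal zero    H = refl
sum-diagonal (suc n) H = begin
  sumUpTo n (λ m → sumUpTo m (λ k → H k (m ∸ k))) +ᶻ sumUpTo (suc n) (λ k → H k (suc n ∸ k))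
    ≡⟨ cong₂ _+ᶻ_ (sum-diagonal n H)
         (cong₂ _+ᶻ_ (sum-cong n (λ k k≤n → cong (H k) (ℕₚ.+-∸-assoc 1 k≤n)))
                     (cong (H (suc n)) (ℕₚ.n∸n≡0 n))) ⟩
  A +ᶻ (B +ᶻ H (suc n) 0)                     ≡⟨ ℤₚ.+-assoc A B _ ⟨
  (A +ᶻ B) +ᶻ H (suc n) 0                     ≡⟨ cong (_+ᶻ H (suc n) 0) (sum-+ n _ _) ⟨
  sumUpTo n (λ k → sumUpTo (suc (n ∸ k)) (H k)) +ᶻ H (suc n) 0
    ≡⟨ cong₂ _+ᶻ_ (sum-cong n (λ k k≤n → cong (λ t → sumUpTo t (H k)) (ℕₚ.+-∸-assoc 1 k≤n)))
                  (cong (λ t → sumUpTo t (H (suc n))) (ℕₚ.n∸n≡0 n)) ⟨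
  sumUpTo (suc n) (λ k → sumUpTo (suc n ∸ k) (H k)) ∎
  where
  open ≡-Reasoning
  A = sumUpTo n (λ k → sumUpTo (n ∸ k) (H k))
  B = sumUpTo n (λ k → H k (suc (n ∸ k)))

0ₚ : PS
0ₚ _ = 0ℤ

_+ₚ_ : PS → PS → PS
(a +ₚ b) n = a n +ᶻ b n

cst : ℤ → PS
cst c zero    = c
cst c (suc _) = 0ℤ

≈ₚ-refl : ∀ {a} → a ≈ₚ a
≈ₚ-refl n = refl

≈ₚ-sym : ∀ {a b} → a ≈ₚ b → b ≈ₚ a
≈ₚ-sym a≈b n = sym (a≈b n)

≈ₚ-trans : ∀ {a b c} → a ≈ₚ b → b ≈ₚ c → a ≈ₚ c
≈ₚ-trans a≈b b≈c n = trans (a≈b n) (b≈c n)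

+ₚ-congˡ : ∀ a {b b′} → b ≈ₚ b′ → (a +ₚ b) ≈ₚ (a +ₚ b′)
+ₚ-congˡ a b≈b′ n = cong (a n +ᶻ_) (b≈b′ n)

+ₚ-congʳ : ∀ b {a a′} → a ≈ₚ a′ → (a +ₚ b) ≈ₚ (a′ +ₚ b)
+ₚ-congʳ b a≈a′ n = cong (_+ᶻ b n) (a≈a′ n)

⊛-cong : ∀ {a a′ b b′} → a ≈ₚ a′ → b ≈ₚ b′ → (a ⊛ b) ≈ₚ (a′ ⊛ b′)
⊛-cong a≈a′ b≈b′ n = sum-cong n (λ i _ → cong₂ _*ᶻ_ (a≈a′ i) (b≈b′ (n ∸ i)))

⊛-congˡ : ∀ a {b b′} → b ≈ₚ b′ → (a ⊛ b) ≈ₚ (a ⊛ b′)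
⊛-congˡ a = ⊛-cong (≈ₚ-refl {a})

⊛-congʳ : ∀ b {a a′} → a ≈ₚ a′ → (a ⊛ b) ≈ₚ (a′ ⊛ b)
⊛-congʳ b a≈a′ = ⊛-cong a≈a′ (≈ₚ-refl {b})

⊛-comm : ∀ a b → (a ⊛ b) ≈ₚ (b ⊛ a)
⊛-comm a b n = trans (sum-reverse n _) (sum-cong n λ i i≤n → begin
  a (n ∸ i) *ᶻ b (n ∸ (n ∸ i))  ≡⟨ cong (λ t → a (n ∸ i) *ᶻ b t) (ℕₚ.m∸[m∸n]≡n i≤n) ⟩
  a (n ∸ i) *ᶻ b i              ≡⟨ ℤₚ.*-comm (a (n ∸ i)) (b i) ⟩
  b i *ᶻ a (n ∸ i)              ∎)
  where open ≡-Reasoning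

⊛-assoc : ∀ a b c → ((a ⊛ b) ⊛ c) ≈ₚ (a ⊛ (b ⊛ c))
⊛-assoc a b c n = begin
  sumUpTo n (λ m → sumUpTo m (λ i → a i *ᶻ b (m ∸ i)) *ᶻ c (n ∸ m))
    ≡⟨ sum-cong n (λ m _ → trans (sum-*ʳ m _ _) (sum-cong m λ i i≤m →
         cong (λ t → (a i *ᶻ b (m ∸ i)) *ᶻ c (n ∸ t)) (sym (ℕₚ.m+[n∸m]≡n i≤m)))) ⟩
  sumUpTo n (λ m → sumUpTo m (λ i → H i (m ∸ i)))   ≡⟨ sum-diagonal n H ⟩
  sumUpTo n (λ i → sumUpTo (n ∸ i) (H i))
    ≡⟨ sum-cong n (λ i _ → trans (sum-cong (n ∸ i) λ j _ →
           trans (ℤₚ.*-assoc (a i) (b j) _) (cong (λ t → a i *ᶻ (b j *ᶻ c t)) (sym (ℕₚ.∸-+-assoc n i j))))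
         (sym (sum-*ˡ (n ∸ i) (a i) _))) ⟩
  (a ⊛ (b ⊛ c)) n ∎
  where
  open ≡-Reasoning
  H : ℕ → ℕ → ℤ
  H i j = (a i *ᶻ b j) *ᶻ c (n ∸ (i + j))

cst-⊛ : ∀ c a → (cst c ⊛ a) ≈ₚ (λ n → c *ᶻ a n)
cst-⊛ c a n = sum-head n _ (λ _ → refl)

⊛-identityˡ : ∀ a → (one ⊛ a) ≈ₚ a
⊛-identityˡ a n = trans (sum-head n _ (λ _ → refl)) (ℤₚ.*-identityˡ (a n))

⊛-distribʳ : ∀ a b c → ((b +ₚ c) ⊛ a) ≈ₚ ((b ⊛ a) +ₚ (c ⊛ a))
⊛-distribʳ a b c n = trans (sum-cong n (λ i _ → ℤₚ.*-distribʳ-+ (a (n ∸ i)) (b i) (c i))) (sum-+ n _ _)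

⊛-zeroˡ : ∀ a → (0ₚ ⊛ a) ≈ₚ 0ₚ
⊛-zeroˡ a n = sum-zero n (λ _ _ → refl)

PS-commutativeSemiring : CommutativeSemiring 0ℓ 0ℓ
PS-commutativeSemiring = record
  { Carrier = PS ; _≈_ = _≈ₚ_ ; _+_ = _+ₚ_ ; _*_ = _⊛_ ; 0# = 0ₚ ; 1# = one
  ; isCommutativeSemiring = isCommutativeSemiringˡ record
    { +-isCommutativeMonoid = Pointwise.isCommutativeMonoid ℕ ℤₚ.+-0-isCommutativeMonoid
    ; *-isCommutativeMonoid = ⊛-isCommutativeMonoid
    ; distribʳ = ⊛-distribʳ
    ; zeroˡ = ⊛-zeroˡ
    }
  }
  where
  ⊛-isCommutativeMonoid : IsCommutativeMonoid _≈ₚ_ _⊛_ one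
  ⊛-isCommutativeMonoid = record
    { isMonoid = record
      { isSemigroup = record
        { isMagma = record
          { isEquivalence = record { refl = ≈ₚ-refl ; sym = ≈ₚ-sym ; trans = ≈ₚ-trans }
          ; ∙-cong = ⊛-cong }
        ; assoc = ⊛-assoc }
      ; identity = ⊛-identityˡ , λ a → ≈ₚ-trans (⊛-comm a one) (⊛-identityˡ a) }
    ; comm = ⊛-comm }

open CommutativeSemiring PS-commutativeSemiring
  using (setoid) renaming (*-identityʳ to ⊛-identityʳ; distribˡ to ⊛-distribˡ; zeroʳ to ⊛-zeroʳ)
open import Algebra.Solver.Ring.NaturalCoefficients.Default PS-commutativeSemiring
  using (solve; con; _:+_; _:*_; _:=_)
open CommSemigroupProperties (CommutativeSemiring.*-commutativeSemigroup PS-commutativeSemiring)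
  using () renaming (interchange to ⊛-interchange)

module ≈ₚ-Reasoning = Relation.Binary.Reasoning.Setoid setoid

X-shift : ∀ a n → (X ⊛ a) (suc n) ≡ a n
X-shift a n = begin
  (X ⊛ a) (suc n)                                 ≡⟨ sum-split-head n _ ⟩
  0ℤ +ᶻ sumUpTo n (λ i → X (suc i) *ᶻ a (n ∸ i))  ≡⟨ ℤₚ.+-identityˡ _ ⟩
  sumUpTo n (λ i → X (suc i) *ᶻ a (n ∸ i))        ≡⟨ sum-head n _ (λ _ → refl) ⟩
  1ℤ *ᶻ a n                                       ≡⟨ ℤₚ.*-identityˡ (a n) ⟩
  a n                                             ∎
  where open ≡-Reasoning

powX-shift : ∀ c a m → (pow X c ⊛ a) (c + m) ≡ a m
powX-shift zero    a m = ⊛-identityˡ a m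
powX-shift (suc c) a m = begin
  ((X ⊛ pow X c) ⊛ a) (suc (c + m))  ≡⟨ ⊛-assoc X (pow X c) a (suc (c + m)) ⟩
  (X ⊛ (pow X c ⊛ a)) (suc (c + m))  ≡⟨ X-shift (pow X c ⊛ a) (c + m) ⟩
  (pow X c ⊛ a) (c + m)              ≡⟨ powX-shift c a m ⟩
  a m                                ∎
  where open ≡-Reasoning

pow-cong : ∀ {a b} k → a ≈ₚ b → pow a k ≈ₚ pow b k
pow-cong zero    a≈b = ≈ₚ-refl
pow-cong (suc k) a≈b = ⊛-cong a≈b (pow-cong k a≈b)

pow-⊛ : ∀ a b k → pow (a ⊛ b) k ≈ₚ (pow a k ⊛ pow b k)
pow-⊛ a b zero    = ≈ₚ-sym (⊛-identityˡ one)
pow-⊛ a b (suc k) = ≈ₚ-trans (⊛-congˡ (a ⊛ b) (pow-⊛ a b k)) (⊛-interchange a b (pow a k) (pow b k))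

pow-+ : ∀ a i j → pow a (i + j) ≈ₚ (pow a i ⊛ pow a j)
pow-+ a zero    j = ≈ₚ-sym (⊛-identityˡ (pow a j))
pow-+ a (suc i) j = ≈ₚ-trans (⊛-congˡ a (pow-+ a i j)) (≈ₚ-sym (⊛-assoc a (pow a i) (pow a j)))

pow-one : ∀ k → pow one k ≈ₚ one
pow-one zero    = ≈ₚ-refl
pow-one (suc k) = ≈ₚ-trans (⊛-congˡ one (pow-one k)) (⊛-identityˡ one)

pow-vanishes-below : ∀ {a} → a 0 ≡ 0ℤ → ∀ k n → n < k → pow a k n ≡ 0ℤ
pow-vanishes-below {a} a₀≡0 (suc k) zero    _         = cong (_*ᶻ pow a k 0) a₀≡0
pow-vanishes-below {a} a₀≡0 (suc k) (suc n) (s≤s n<k) = begin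
  (a ⊛ pow a k) (suc n)                                       ≡⟨ sum-split-head n _ ⟩
  a 0 *ᶻ pow a k (suc n) +ᶻ sumUpTo n (λ i → a (suc i) *ᶻ pow a k (n ∸ i))
    ≡⟨ cong₂ _+ᶻ_ (cong (_*ᶻ pow a k (suc n)) a₀≡0) (sum-zero n λ i _ →
         trans (cong (a (suc i) *ᶻ_) (pow-vanishes-below a₀≡0 k (n ∸ i) (ℕₚ.≤-<-trans (ℕₚ.m∸n≤m n i) n<k)))
               (ℤₚ.*-zeroʳ (a (suc i)))) ⟩
  0ℤ                                                          ∎
  where open ≡-Reasoning

module Composition (φ : PS) (φ₀≡0 : φ 0 ≡ 0ℤ) where

  compose-extend : ∀ a {i n} → i ≤ n → compose a φ i ≡ sumUpTo n (λ k → a k *ᶻ pow φ k i)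
  compose-extend a i≤n = sum-extend i≤n λ j i<j _ →
    trans (cong (a j *ᶻ_) (pow-vanishes-below φ₀≡0 j _ i<j)) (ℤₚ.*-zeroʳ (a j))

  compose-cong : ∀ {a b} → a ≈ₚ b → compose a φ ≈ₚ compose b φ
  compose-cong a≈b n = sum-cong n (λ k _ → cong (_*ᶻ pow φ k n) (a≈b k))

  compose-one : compose one φ ≈ₚ one
  compose-one n = trans (sum-head n _ (λ _ → refl)) (ℤₚ.*-identityˡ (one n))

  compose-X : compose X φ ≈ₚ φ
  compose-X zero    = sym φ₀≡0
  compose-X (suc n) = begin
    compose X φ (suc n)                                            ≡⟨ sum-split-head n _ ⟩
    0ℤ +ᶻ sumUpTo n (λ k → X (suc k) *ᶻ pow φ (suc k) (suc n))     ≡⟨ ℤₚ.+-identityˡ _ ⟩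
    sumUpTo n (λ k → X (suc k) *ᶻ pow φ (suc k) (suc n))           ≡⟨ sum-head n _ (λ _ → refl) ⟩
    1ℤ *ᶻ pow φ 1 (suc n)                                          ≡⟨ ℤₚ.*-identityˡ _ ⟩
    (φ ⊛ one) (suc n)                                              ≡⟨ ⊛-identityʳ φ (suc n) ⟩
    φ (suc n)                                                      ∎
    where open ≡-Reasoning

  compose-⊛ : ∀ a b → compose (a ⊛ b) φ ≈ₚ (compose a φ ⊛ compose b φ)
  compose-⊛ a b n = begin
    sumUpTo n (λ m → sumUpTo m (λ k → a k *ᶻ b (m ∸ k)) *ᶻ pow φ m n)
      ≡⟨ sum-cong n (λ m _ → trans (sum-*ʳ m _ _) (sum-cong m λ k k≤m →
           cong (λ t → (a k *ᶻ b (m ∸ k)) *ᶻ pow φ t n) (sym (ℕₚ.m+[n∸m]≡n k≤m)))) ⟩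
    sumUpTo n (λ m → sumUpTo m (λ k → H k (m ∸ k)))              ≡⟨ sum-diagonal n H ⟩
    sumUpTo n (λ k → sumUpTo (n ∸ k) (H k))
      ≡⟨ sum-cong n (λ k _ → sum-extend (ℕₚ.m∸n≤m n k) λ l n∸k<l _ →
           trans (cong ((a k *ᶻ b l) *ᶻ_) (pow-vanishes-below φ₀≡0 (k + l) n
                    (ℕₚ.≤-<-trans (ℕₚ.m≤n+m∸n n k) (ℕₚ.+-monoʳ-< k n∸k<l))))
                 (ℤₚ.*-zeroʳ (a k *ᶻ b l))) ⟩
    sumUpTo n (λ k → sumUpTo n (H k))
      ≡⟨ sum-cong n (λ k _ → sum-cong n λ l _ →
           trans (cong ((a k *ᶻ b l) *ᶻ_) (pow-+ φ k l n)) (sum-*ˡ n (a k *ᶻ b l) _)) ⟩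
    sumUpTo n (λ k → sumUpTo n (λ l → sumUpTo n (T k l)))       ≡⟨ sum-cong n (λ k _ → sum-swap n n (T k)) ⟩
    sumUpTo n (λ k → sumUpTo n (λ i → sumUpTo n (λ l → T k l i))) ≡⟨ sum-swap n n _ ⟩
    sumUpTo n (λ i → sumUpTo n (λ k → sumUpTo n (λ l → T k l i)))
      ≡⟨ sum-cong n (λ i i≤n → begin
           sumUpTo n (λ k → sumUpTo n (λ l → T k l i))
             ≡⟨ sum-cong n (λ k _ → sum-cong n λ l _ → *ᶻ-interchange (a k) (b l) _ _) ⟩
           sumUpTo n (λ k → sumUpTo n (λ l → (a k *ᶻ pow φ k i) *ᶻ (b l *ᶻ pow φ l (n ∸ i))))
             ≡⟨ sum-product n _ _ ⟨
           sumUpTo n (λ k → a k *ᶻ pow φ k i) *ᶻ sumUpTo n (λ l → b l *ᶻ pow φ l (n ∸ i))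
             ≡⟨ cong₂ _*ᶻ_ (compose-extend a i≤n) (compose-extend b (ℕₚ.m∸n≤m n i)) ⟨
           compose a φ i *ᶻ compose b φ (n ∸ i) ∎) ⟩
    (compose a φ ⊛ compose b φ) n ∎
    where
    open ≡-Reasoning
    H : ℕ → ℕ → ℤ
    H k l = (a k *ᶻ b l) *ᶻ pow φ (k + l) n
    T : ℕ → ℕ → ℕ → ℤ
    T k l i = (a k *ᶻ b l) *ᶻ (pow φ k i *ᶻ pow φ l (n ∸ i))

  compose-pow : ∀ a k → compose (pow a k) φ ≈ₚ pow (compose a φ) k
  compose-pow a zero    = compose-one
  compose-pow a (suc k) =
    ≈ₚ-trans (compose-⊛ a (pow a k)) (⊛-congˡ (compose a φ) (compose-pow a k))

  ⊛-compose-coeff : ∀ Q P N → (Q ⊛ compose P φ) N ≡ sumUpTo N (λ m → P m *ᶻ (Q ⊛ pow φ m) N)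
  ⊛-compose-coeff Q P N = begin
    sumUpTo N (λ i → Q i *ᶻ compose P φ (N ∸ i))
      ≡⟨ sum-cong N (λ i _ → trans (cong (Q i *ᶻ_) (compose-extend P (ℕₚ.m∸n≤m N i))) (sum-*ˡ N (Q i) _)) ⟩
    sumUpTo N (λ i → sumUpTo N (λ m → Q i *ᶻ (P m *ᶻ pow φ m (N ∸ i))))
      ≡⟨ sum-swap N N _ ⟩
    sumUpTo N (λ m → sumUpTo N (λ i → Q i *ᶻ (P m *ᶻ pow φ m (N ∸ i))))
      ≡⟨ sum-cong N (λ m _ → trans (sum-cong N (λ i _ → *ᶻ-left-comm (Q i) (P m) _))
                                   (sym (sum-*ˡ N (P m) _))) ⟩
    sumUpTo N (λ m → P m *ᶻ (Q ⊛ pow φ m) N) ∎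
    where open ≡-Reasoning

-- x d/dx rather than d/dx: it preserves degrees, so no index shifts arise.
euler : PS → PS
euler a n = + n *ᶻ a n

euler-cong : ∀ {a b} → a ≈ₚ b → euler a ≈ₚ euler b
euler-cong a≈b n = cong (+ n *ᶻ_) (a≈b n)

euler-one : euler one ≈ₚ 0ₚ
euler-one zero    = refl
euler-one (suc n) = ℤₚ.*-zeroʳ (+ suc n)

euler-⊛ : ∀ a b → euler (a ⊛ b) ≈ₚ ((euler a ⊛ b) +ₚ (a ⊛ euler b))
euler-⊛ a b n = trans (sum-*ˡ n (+ n) _) (trans (sum-cong n leibniz) (sum-+ n _ _))
  where
  open ≡-Reasoning
  leibniz : ∀ i → i ≤ n →
            + n *ᶻ (a i *ᶻ b (n ∸ i)) ≡ (+ i *ᶻ a i) *ᶻ b (n ∸ i) +ᶻ a i *ᶻ (+ (n ∸ i) *ᶻ b (n ∸ i))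
  leibniz i i≤n = begin
    + n *ᶻ (a i *ᶻ b (n ∸ i))
      ≡⟨ cong (λ t → + t *ᶻ (a i *ᶻ b (n ∸ i))) (sym (ℕₚ.m+[n∸m]≡n i≤n)) ⟩
    (+ i +ᶻ + (n ∸ i)) *ᶻ (a i *ᶻ b (n ∸ i))    ≡⟨ ℤₚ.*-distribʳ-+ _ (+ i) (+ (n ∸ i)) ⟩
    + i *ᶻ (a i *ᶻ b (n ∸ i)) +ᶻ + (n ∸ i) *ᶻ (a i *ᶻ b (n ∸ i))
      ≡⟨ cong₂ _+ᶻ_ (sym (ℤₚ.*-assoc (+ i) (a i) _)) (*ᶻ-left-comm (+ (n ∸ i)) (a i) _) ⟩
    (+ i *ᶻ a i) *ᶻ b (n ∸ i) +ᶻ a i *ᶻ (+ (n ∸ i) *ᶻ b (n ∸ i)) ∎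

cst-suc : ∀ t → cst (+ suc t) ≈ₚ (one +ₚ cst (+ t))
cst-suc t zero    = refl
cst-suc t (suc _) = refl

euler-pow : ∀ a t → (a ⊛ euler (pow a t)) ≈ₚ (cst (+ t) ⊛ (pow a t ⊛ euler a))
euler-pow a zero    = begin
  a ⊛ euler one                ≈⟨ ⊛-congˡ a euler-one ⟩
  a ⊛ 0ₚ                       ≈⟨ ⊛-zeroʳ a ⟩
  0ₚ                           ≈⟨ cst-⊛ 0ℤ (one ⊛ euler a) ⟨
  cst 0ℤ ⊛ (one ⊛ euler a)     ∎
  where open ≈ₚ-Reasoning
euler-pow a (suc t) = begin
  a ⊛ euler (a ⊛ pow a t)                               ≈⟨ ⊛-congˡ a (euler-⊛ a (pow a t)) ⟩
  a ⊛ ((euler a ⊛ pow a t) +ₚ (a ⊛ euler (pow a t)))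
    ≈⟨ ⊛-congˡ a (+ₚ-congˡ (euler a ⊛ pow a t) (euler-pow a t)) ⟩
  a ⊛ ((euler a ⊛ pow a t) +ₚ (c ⊛ (pow a t ⊛ euler a)))
    ≈⟨ solve 4 (λ a e p c → a :* ((e :* p) :+ (c :* (p :* e))) := (con 1 :+ c) :* ((a :* p) :* e))
             ≈ₚ-refl a (euler a) (pow a t) c ⟩
  (one +ₚ c) ⊛ (pow a (suc t) ⊛ euler a)                ≈⟨ ⊛-congʳ (pow a (suc t) ⊛ euler a) (cst-suc t) ⟨
  cst (+ suc t) ⊛ (pow a (suc t) ⊛ euler a)             ∎
  where
  open ≈ₚ-Reasoning
  c = cst (+ t)

module Lagrange (φ ψ W : PS) (φ≈X⊛ψ : φ ≈ₚ (X ⊛ ψ)) (W⊛ψ≈one : (W ⊛ ψ) ≈ₚ one) where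

  open Composition φ (φ≈X⊛ψ 0)

  deriv-φ : deriv φ ≈ₚ (ψ +ₚ euler ψ)
  deriv-φ n = begin
    + suc n *ᶻ φ (suc n)       ≡⟨ cong (+ suc n *ᶻ_) (trans (φ≈X⊛ψ (suc n)) (X-shift ψ n)) ⟩
    (1ℤ +ᶻ + n) *ᶻ ψ n         ≡⟨ ℤₚ.*-distribʳ-+ (ψ n) 1ℤ (+ n) ⟩
    1ℤ *ᶻ ψ n +ᶻ + n *ᶻ ψ n    ≡⟨ cong (_+ᶻ + n *ᶻ ψ n) (ℤₚ.*-identityˡ (ψ n)) ⟩
    ψ n +ᶻ + n *ᶻ ψ n          ∎
    where open ≡-Reasoning

  pow-W⊛pow-ψ : ∀ m → (pow W m ⊛ pow ψ m) ≈ₚ one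
  pow-W⊛pow-ψ m = ≈ₚ-trans (≈ₚ-sym (pow-⊛ W ψ m)) (≈ₚ-trans (pow-cong m W⊛ψ≈one) (pow-one m))

  pow-W-suc⊛ψ : ∀ j → (pow W (suc j) ⊛ ψ) ≈ₚ pow W j
  pow-W-suc⊛ψ j = begin
    (W ⊛ pow W j) ⊛ ψ    ≈⟨ solve 3 (λ w v s → (w :* v) :* s := (w :* s) :* v) ≈ₚ-refl W (pow W j) ψ ⟩
    (W ⊛ ψ) ⊛ pow W j    ≈⟨ ⊛-congʳ (pow W j) W⊛ψ≈one ⟩
    one ⊛ pow W j        ≈⟨ ⊛-identityˡ (pow W j) ⟩
    pow W j              ∎
    where open ≈ₚ-Reasoning

  euler-W : (euler W +ₚ (W ⊛ (W ⊛ euler ψ))) ≈ₚ 0ₚ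
  euler-W = begin
    euler W +ₚ V                 ≈⟨ +ₚ-congʳ V (⊛-identityˡ (euler W)) ⟨
    (one ⊛ euler W) +ₚ V         ≈⟨ +ₚ-congʳ V (⊛-congʳ (euler W) W⊛ψ≈one) ⟨
    ((W ⊛ ψ) ⊛ euler W) +ₚ V
      ≈⟨ solve 4 (λ w s e d → ((w :* s) :* e) :+ (w :* (w :* d)) := w :* ((e :* s) :+ (w :* d)))
               ≈ₚ-refl W ψ (euler W) (euler ψ) ⟩
    W ⊛ ((euler W ⊛ ψ) +ₚ (W ⊛ euler ψ))         ≈⟨ ⊛-congˡ W (euler-⊛ W ψ) ⟨
    W ⊛ euler (W ⊛ ψ)                            ≈⟨ ⊛-congˡ W (≈ₚ-trans (euler-cong W⊛ψ≈one) euler-one) ⟩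
    W ⊛ 0ₚ                                       ≈⟨ ⊛-zeroʳ W ⟩
    0ₚ                                           ∎
    where
    open ≈ₚ-Reasoning
    V = W ⊛ (W ⊛ euler ψ)

  -- x (ψ^(-j))′ = -j ψ^(-j-1) x ψ′, with the negative term moved to the left.
  euler-pow-W : ∀ j → (euler (pow W j) +ₚ (cst (+ j) ⊛ (pow W (suc j) ⊛ euler ψ))) ≈ₚ 0ₚ
  euler-pow-W j = begin
    Z                                                      ≈⟨ ⊛-identityˡ Z ⟨
    one ⊛ Z                                                ≈⟨ ⊛-congʳ Z (≈ₚ-trans (⊛-comm ψ W) W⊛ψ≈one) ⟨
    (ψ ⊛ W) ⊛ Z
      ≈⟨ solve 6 (λ s w v c e d → (s :* w) :* (e :+ (c :* ((w :* v) :* d)))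
                                  := s :* ((w :* e) :+ ((c :* v) :* (w :* (w :* d)))))
               ≈ₚ-refl ψ W v c (euler v) (euler ψ) ⟩
    ψ ⊛ ((W ⊛ euler v) +ₚ ((c ⊛ v) ⊛ (W ⊛ (W ⊛ euler ψ))))
      ≈⟨ ⊛-congˡ ψ (+ₚ-congʳ ((c ⊛ v) ⊛ (W ⊛ (W ⊛ euler ψ))) (euler-pow W j)) ⟩
    ψ ⊛ ((c ⊛ (v ⊛ euler W)) +ₚ ((c ⊛ v) ⊛ (W ⊛ (W ⊛ euler ψ))))
      ≈⟨ solve 6 (λ s w v c e d → s :* ((c :* (v :* e)) :+ ((c :* v) :* (w :* (w :* d))))
                                  := (s :* (c :* v)) :* (e :+ (w :* (w :* d))))
               ≈ₚ-refl ψ W v c (euler W) (euler ψ) ⟩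
    (ψ ⊛ (c ⊛ v)) ⊛ (euler W +ₚ (W ⊛ (W ⊛ euler ψ)))     ≈⟨ ⊛-congˡ (ψ ⊛ (c ⊛ v)) euler-W ⟩
    (ψ ⊛ (c ⊛ v)) ⊛ 0ₚ                                   ≈⟨ ⊛-zeroʳ (ψ ⊛ (c ⊛ v)) ⟩
    0ₚ                                                   ∎
    where
    open ≈ₚ-Reasoning
    c = cst (+ j)
    v = pow W j
    Z = euler v +ₚ (c ⊛ ((W ⊛ v) ⊛ euler ψ))

  coeff-pow-W-deriv-φ-split : ∀ j →
    (pow W (suc j) ⊛ deriv φ) j ≡ pow W j j +ᶻ (pow W (suc j) ⊛ euler ψ) j
  coeff-pow-W-deriv-φ-split j = begin
    (pow W (suc j) ⊛ deriv φ) j             ≡⟨ ⊛-congˡ (pow W (suc j)) deriv-φ j ⟩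
    (pow W (suc j) ⊛ (ψ +ₚ euler ψ)) j      ≡⟨ ⊛-distribˡ (pow W (suc j)) ψ (euler ψ) j ⟩
    (pow W (suc j) ⊛ ψ) j +ᶻ M j            ≡⟨ cong (_+ᶻ M j) (pow-W-suc⊛ψ j j) ⟩
    pow W j j +ᶻ M j                        ∎
    where
    open ≡-Reasoning
    M = pow W (suc j) ⊛ euler ψ

  coeff-pow-W-deriv-φ : ∀ j → (pow W (suc j) ⊛ deriv φ) j ≡ one j
  coeff-pow-W-deriv-φ zero    =
    trans (coeff-pow-W-deriv-φ-split 0) (cong (1ℤ +ᶻ_) (ℤₚ.*-zeroʳ (pow W 1 0)))
  coeff-pow-W-deriv-φ (suc t) = ℤₚ.*-cancelˡ-≡ (+ j) _ 0ℤ (begin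
    + j *ᶻ ((pow W (suc j) ⊛ deriv φ) j)       ≡⟨ cong (+ j *ᶻ_) (coeff-pow-W-deriv-φ-split j) ⟩
    + j *ᶻ (pow W j j +ᶻ M j)                  ≡⟨ ℤₚ.*-distribˡ-+ (+ j) (pow W j j) (M j) ⟩
    + j *ᶻ pow W j j +ᶻ + j *ᶻ M j             ≡⟨ cong (+ j *ᶻ pow W j j +ᶻ_) (cst-⊛ (+ j) M j) ⟨
    + j *ᶻ pow W j j +ᶻ (cst (+ j) ⊛ M) j      ≡⟨ euler-pow-W j j ⟩
    0ℤ                                         ≡⟨ ℤₚ.*-zeroʳ (+ j) ⟨
    + j *ᶻ 0ℤ                                  ∎)
    where
    open ≡-Reasoning
    j = suc t
    M = pow W (suc j) ⊛ euler ψ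

  pow-W⊛deriv-φ⊛pow-φ : ∀ m j →
    ((pow W (suc (m + j)) ⊛ deriv φ) ⊛ pow φ m) ≈ₚ (pow X m ⊛ (pow W (suc j) ⊛ deriv φ))
  pow-W⊛deriv-φ⊛pow-φ m j = begin
    (pow W (suc (m + j)) ⊛ deriv φ) ⊛ pow φ m
      ≈⟨ ⊛-cong (⊛-congʳ (deriv φ) (λ n → cong (λ i → pow W i n) (sym (ℕₚ.+-suc m j))))
                (≈ₚ-trans (pow-cong m φ≈X⊛ψ) (pow-⊛ X ψ m)) ⟩
    (pow W (m + suc j) ⊛ deriv φ) ⊛ (pow X m ⊛ pow ψ m)
      ≈⟨ ⊛-congʳ (pow X m ⊛ pow ψ m) (⊛-congʳ (deriv φ) (pow-+ W m (suc j))) ⟩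
    ((pow W m ⊛ pow W (suc j)) ⊛ deriv φ) ⊛ (pow X m ⊛ pow ψ m)
      ≈⟨ solve 5 (λ a b d x q → ((a :* b) :* d) :* (x :* q) := x :* ((a :* q) :* (b :* d)))
               ≈ₚ-refl (pow W m) (pow W (suc j)) (deriv φ) (pow X m) (pow ψ m) ⟩
    pow X m ⊛ ((pow W m ⊛ pow ψ m) ⊛ Y)
      ≈⟨ ⊛-congˡ (pow X m) (≈ₚ-trans (⊛-congʳ Y (pow-W⊛pow-ψ m)) (⊛-identityˡ Y)) ⟩
    pow X m ⊛ Y ∎
    where
    open ≈ₚ-Reasoning
    Y = pow W (suc j) ⊛ deriv φ

  coeff-pow-W-deriv-φ-pow-φ : ∀ {m N} → m ≤ N → ((pow W (suc N) ⊛ deriv φ) ⊛ pow φ m) N ≡ one (N ∸ m)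
  coeff-pow-W-deriv-φ-pow-φ {m} m≤N with ℕₚ.m≤n⇒∃[o]m+o≡n m≤N
  ... | j , refl = begin
    ((pow W (suc (m + j)) ⊛ deriv φ) ⊛ pow φ m) (m + j)  ≡⟨ pow-W⊛deriv-φ⊛pow-φ m j (m + j) ⟩
    (pow X m ⊛ (pow W (suc j) ⊛ deriv φ)) (m + j)        ≡⟨ powX-shift m (pow W (suc j) ⊛ deriv φ) j ⟩
    (pow W (suc j) ⊛ deriv φ) j                          ≡⟨ coeff-pow-W-deriv-φ j ⟩
    one j                                                ≡⟨ cong one (ℕₚ.m+n∸m≡n m j) ⟨
    one (m + j ∸ m)                                      ∎
    where open ≡-Reasoning

  lagrange-inversion : ∀ P N → ((pow W (suc N) ⊛ deriv φ) ⊛ compose P φ) N ≡ P N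
  lagrange-inversion P N = begin
    (Q ⊛ compose P φ) N                       ≡⟨ ⊛-compose-coeff Q P N ⟩
    sumUpTo N (λ m → P m *ᶻ (Q ⊛ pow φ m) N)
      ≡⟨ sum-cong N (λ m m≤N → cong (P m *ᶻ_) (coeff-pow-W-deriv-φ-pow-φ m≤N)) ⟩
    (P ⊛ one) N                               ≡⟨ ⊛-identityʳ P N ⟩
    P N                                       ∎
    where
    open ≡-Reasoning
    Q = pow W (suc N) ⊛ deriv φ

  pow-φ-double : ∀ k → pow φ (k + k) ≈ₚ (pow X k ⊛ pow (φ ⊛ ψ) k)
  pow-φ-double k = begin
    pow φ (k + k)                          ≈⟨ pow-+ φ k k ⟩
    pow φ k ⊛ pow φ k                      ≈⟨ ⊛-congʳ (pow φ k) (≈ₚ-trans (pow-cong k φ≈X⊛ψ) (pow-⊛ X ψ k)) ⟩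
    (pow X k ⊛ pow ψ k) ⊛ pow φ k
      ≈⟨ solve 3 (λ x s f → (x :* s) :* f := x :* (f :* s)) ≈ₚ-refl (pow X k) (pow ψ k) (pow φ k) ⟩
    pow X k ⊛ (pow φ k ⊛ pow ψ k)          ≈⟨ ⊛-congˡ (pow X k) (pow-⊛ φ ψ k) ⟨
    pow X k ⊛ pow (φ ⊛ ψ) k                ∎
    where open ≈ₚ-Reasoning

  lagrange-riordan-factor : ∀ G N k →
    ((pow W (suc N) ⊛ deriv φ) ⊛ ((G ⊛ pow φ (k + k)) ⊛ pow ψ (suc N)))
      ≈ₚ (pow X k ⊛ ((deriv φ ⊛ G) ⊛ pow (φ ⊛ ψ) k))
  lagrange-riordan-factor G N k = begin
    (pow W (suc N) ⊛ deriv φ) ⊛ ((G ⊛ pow φ (k + k)) ⊛ pow ψ (suc N))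
      ≈⟨ ⊛-congˡ (pow W (suc N) ⊛ deriv φ) (⊛-congʳ (pow ψ (suc N)) (⊛-congˡ G (pow-φ-double k))) ⟩
    (pow W (suc N) ⊛ deriv φ) ⊛ ((G ⊛ (pow X k ⊛ r)) ⊛ pow ψ (suc N))
      ≈⟨ solve 6 (λ a d g x r b → (a :* d) :* ((g :* (x :* r)) :* b) := x :* ((a :* b) :* ((d :* g) :* r)))
               ≈ₚ-refl (pow W (suc N)) (deriv φ) G (pow X k) r (pow ψ (suc N)) ⟩
    pow X k ⊛ ((pow W (suc N) ⊛ pow ψ (suc N)) ⊛ Y)
      ≈⟨ ⊛-congˡ (pow X k) (≈ₚ-trans (⊛-congʳ Y (pow-W⊛pow-ψ (suc N))) (⊛-identityˡ Y)) ⟩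
    pow X k ⊛ Y ∎
    where
    open ≈ₚ-Reasoning
    r = pow (φ ⊛ ψ) k
    Y = (deriv φ ⊛ G) ⊛ r

  lagrange-riordan-coeff : ∀ G n k →
    ((pow W (suc (n + k)) ⊛ deriv φ) ⊛ ((G ⊛ pow φ (k + k)) ⊛ pow ψ (suc (n + k)))) (n + k)
      ≡ riordan (deriv φ ⊛ G) (φ ⊛ ψ) n k
  lagrange-riordan-coeff G n k = begin
    ((pow W (suc (n + k)) ⊛ deriv φ) ⊛ ((G ⊛ pow φ (k + k)) ⊛ pow ψ (suc (n + k)))) (n + k)
      ≡⟨ lagrange-riordan-factor G (n + k) k (n + k) ⟩
    (pow X k ⊛ Y) (n + k)      ≡⟨ cong (pow X k ⊛ Y) (ℕₚ.+-comm n k) ⟩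
    (pow X k ⊛ Y) (k + n)      ≡⟨ powX-shift k Y n ⟩
    Y n                        ∎
    where
    open ≡-Reasoning
    Y = (deriv φ ⊛ G) ⊛ pow (φ ⊛ ψ) k

X⊛-cancel : ∀ {a b} → (X ⊛ a) ≈ₚ (X ⊛ b) → a ≈ₚ b
X⊛-cancel {a} {b} Xa≈Xb n = trans (sym (X-shift a n)) (trans (Xa≈Xb (suc n)) (X-shift b n))

X⊛-tail : ∀ a → a 0 ≡ 0ℤ → a ≈ₚ (X ⊛ (λ n → a (suc n)))
X⊛-tail a a₀≡0 zero    = a₀≡0
X⊛-tail a a₀≡0 (suc n) = sym (X-shift (λ n → a (suc n)) n)

module Reversion (f u φ : PS) (f₀≡1 : f 0 ≡ 1ℤ) (u⊛f≈X : (u ⊛ f) ≈ₚ X)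
                 (φ₀≡0 : φ 0 ≡ 0ℤ) (u∘φ≈X : compose u φ ≈ₚ X) where

  open Composition φ φ₀≡0

  -- u = x/f, so w = u/x = 1/f and W = w(φ) = x/φ.
  w : PS
  w n = u (suc n)

  ψ : PS
  ψ = compose f φ

  W : PS
  W = compose w φ

  u₀≡0 : u 0 ≡ 0ℤ
  u₀≡0 = begin
    u 0              ≡⟨ ℤₚ.*-identityʳ (u 0) ⟨
    u 0 *ᶻ 1ℤ        ≡⟨ cong (u 0 *ᶻ_) f₀≡1 ⟨
    u 0 *ᶻ f 0       ≡⟨ u⊛f≈X 0 ⟩
    0ℤ               ∎
    where open ≡-Reasoning

  w⊛f≈one : (w ⊛ f) ≈ₚ one
  w⊛f≈one = X⊛-cancel (begin
    X ⊛ (w ⊛ f)     ≈⟨ ⊛-assoc X w f ⟨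
    (X ⊛ w) ⊛ f     ≈⟨ ⊛-congʳ f (X⊛-tail u u₀≡0) ⟨
    u ⊛ f           ≈⟨ u⊛f≈X ⟩
    X               ≈⟨ ⊛-identityʳ X ⟨
    X ⊛ one         ∎)
    where open ≈ₚ-Reasoning

  W⊛ψ≈one : (W ⊛ ψ) ≈ₚ one
  W⊛ψ≈one = ≈ₚ-trans (≈ₚ-sym (compose-⊛ w f)) (≈ₚ-trans (compose-cong w⊛f≈one) compose-one)

  φ≈X⊛ψ : φ ≈ₚ (X ⊛ ψ)
  φ≈X⊛ψ = begin
    φ                        ≈⟨ ⊛-identityʳ φ ⟨
    φ ⊛ one                  ≈⟨ ⊛-congˡ φ W⊛ψ≈one ⟨
    φ ⊛ (W ⊛ ψ)              ≈⟨ ⊛-assoc φ W ψ ⟨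
    (φ ⊛ W) ⊛ ψ              ≈⟨ ⊛-congʳ ψ (⊛-congʳ W compose-X) ⟨
    (compose X φ ⊛ W) ⊛ ψ    ≈⟨ ⊛-congʳ ψ (compose-⊛ X w) ⟨
    compose (X ⊛ w) φ ⊛ ψ    ≈⟨ ⊛-congʳ ψ (compose-cong (X⊛-tail u u₀≡0)) ⟨
    compose u φ ⊛ ψ          ≈⟨ ⊛-congʳ ψ u∘φ≈X ⟩
    X ⊛ ψ                    ∎
    where open ≈ₚ-Reasoning

-- The factor x^(2k) stands for the index shift n - k, avoiding truncated subtraction.
riordan-entry-as-coeff : ∀ g f n k →
  riordan g (X ⊛ f) (suc (2 * n)) (suc (n + k)) ≡ ((g ⊛ pow X (k + k)) ⊛ pow f (suc (n + k))) (n + k)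
riordan-entry-as-coeff g f n k = begin
  L (suc (2 * n))                              ≡⟨ powX-shift (k + k) L (suc (2 * n)) ⟨
  (pow X (k + k) ⊛ L) (k + k + suc (2 * n))    ≡⟨ cong (pow X (k + k) ⊛ L) (degree n k) ⟨
  (pow X (k + k) ⊛ L) (suc N + N)              ≡⟨ factor (suc N + N) ⟨
  (pow X (suc N) ⊛ P) (suc N + N)              ≡⟨ powX-shift (suc N) P N ⟩
  P N                                          ∎
  where
  open ≡-Reasoning
  N = n + k
  L = g ⊛ pow (X ⊛ f) (suc N)
  P = (g ⊛ pow X (k + k)) ⊛ pow f (suc N)
  degree : ∀ n k → suc (n + k) + (n + k) ≡ k + k + suc (2 * n)
  degree = solve-∀
  factor : (pow X (suc N) ⊛ P) ≈ₚ (pow X (k + k) ⊛ L)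
  factor = ≈ₚ-trans
    (solve 4 (λ x g y p → x :* ((g :* y) :* p) := y :* (g :* (x :* p)))
             ≈ₚ-refl (pow X (suc N)) g (pow X (k + k)) (pow f (suc N)))
    (⊛-congˡ (pow X (k + k)) (⊛-congˡ g (≈ₚ-sym (pow-⊛ X f (suc N)))))

mainTheorem8 : (g f : PS) → g 0 ≡ 1ℤ → f 0 ≡ 1ℤ →
    (u : PS) → (u ⊛ f) ≈ₚ X →
    (φ : PS) → φ 0 ≡ 0ℤ → compose u φ ≈ₚ X →
    ∀ (n k : ℕ) →
      riordan g (X ⊛ f) (suc (2 * n)) (suc (n + k))
        ≡ riordan (deriv φ ⊛ compose g φ) (φ ⊛ compose f φ) n k
mainTheorem8 g f _ f₀≡1 u u⊛f≈X φ φ₀≡0 u∘φ≈X n k = begin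
  riordan g (X ⊛ f) (suc (2 * n)) (suc (n + k))           ≡⟨ riordan-entry-as-coeff g f n k ⟩
  P N                                                     ≡⟨ lagrange-inversion P N ⟨
  (Q ⊛ compose P φ) N                                     ≡⟨ ⊛-congˡ Q compose-P N ⟩
  (Q ⊛ ((G ⊛ pow φ (k + k)) ⊛ pow ψ (suc N))) N           ≡⟨ lagrange-riordan-coeff G n k ⟩
  riordan (deriv φ ⊛ compose g φ) (φ ⊛ compose f φ) n k   ∎
  where
  open ≡-Reasoning
  open Composition φ φ₀≡0
  open Reversion f u φ f₀≡1 u⊛f≈X φ₀≡0 u∘φ≈X
  open Lagrange φ ψ W φ≈X⊛ψ W⊛ψ≈one
  N = n + k
  G = compose g φ
  P = (g ⊛ pow X (k + k)) ⊛ pow f (suc N)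
  Q = pow W (suc N) ⊛ deriv φ
  compose-P : compose P φ ≈ₚ ((G ⊛ pow φ (k + k)) ⊛ pow ψ (suc N))
  compose-P = ≈ₚ-trans (compose-⊛ (g ⊛ pow X (k + k)) (pow f (suc N)))
    (⊛-cong (≈ₚ-trans (compose-⊛ g (pow X (k + k)))
                      (⊛-congˡ G (≈ₚ-trans (compose-pow X (k + k)) (pow-cong (k + k) compose-X))))
            (compose-pow f (suc N)))
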